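{- Let $\Gamma$ and $\Sigma$ be connected twin-free graphs such that $\Gamma$ is stable and $\Sigma$ is bipartite with parts $U$ and $W$ each of size at least three, and let $\rho\in\mathrm{Aut}(\Gamma\times\Sigma)$ be a $\Gamma$-mixer of $V(\Gamma)\times V(\Sigma)$ that stabilizes $V(\Gamma)\times U$. Suppose that $S(\Gamma)$ is Cartesian-prime. Then the restriction of $\rho$ to $V(\Gamma)\times U$ is a $U$-mixer of $V(\Gamma)\times U$, and the restriction of $\rho$ to $V(\Gamma)\times W$ is a $W$-mixer of $V(\Gamma)\times W$.
   Context: All graphs are finite, undirected, without multiple edges, but possibly with loops. A graph is twin-free if no two distinct vertices have the same neighborhood. The direct product $\Gamma\times\Sigma$ has vertex set $V(\Gamma)\times V(\Sigma)$, with $(u,i)\sim(v,j)$ iff $u\sim v$ in $\Gamma$ and $i\sim j$ in $\Sigma$. A graph $\Gamma$ is stable if $\mathrm{Aut}(\Gamma\times K_2)=\mathrm{Aut}(\Gamma)\times\mathrm{Aut}(K_2)$ (componentwise action). The Cartesian product $\Gamma\Box\Sigma$ has vertex set $V(\Gamma)\times V(\Sigma)$, with $(u,i)\sim(v,j)$ iff either $u=v$ and $i\sim j$ in $\Sigma$, or $i=j$ and $u\sim v$ in $\Gamma$. A graph with more than one vertex is Cartesian-prime if it is not isomorphic to a Cartesian product of two graphs each with fewer vertices. For sets $A,B$, the $A$-partition of $A\times B$ is $\{\{a\}\times B:a\in A\}$ and the $B$-partition is $\{A\times\{b\}:b\in B\}$; a permutation of $A\times B$ is an $A$-mixer (resp.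 $B$-mixer) if it does not preserve (i.e. does not permute the blocks of) the $A$-partition (resp. $B$-partition). A $\Gamma$-mixer of $V(\Gamma)\times V(\Sigma)$ means a $V(\Gamma)$-mixer. Thus a $U$-mixer of $V(\Gamma)\times U$ is a permutation not preserving $\{V(\Gamma)\times\{u\}:u\in U\}$. For a graph $\Gamma$, $B(\Gamma)$ is the graph on $V(\Gamma)$ whose edges are the pairs $\{u,v\}$ with $u\neq v$ and $N_\Gamma(u)\cap N_\Gamma(v)\neq\emptyset$. An edge $\{u,v\}$ of $B(\Gamma)$ is dispensable if there exists $w\in V(\Gamma)$ such that both (i) $N_\Gamma(u)\cap N_\Gamma(v)\subsetneq N_\Gamma(u)\cap N_\Gamma(w)$ or $N_\Gamma(u)\subsetneq N_\Gamma(w)\subsetneq N_\Gamma(v)$, and (ii) $N_\Gamma(v)\cap N_\Gamma(u)\subsetneq N_\Gamma(v)\cap N_\Gamma(w)$ or $N_\Gamma(v)\subsetneq N_\Gamma(w)\subsetneq N_\Gamma(u)$. The Cartesian skeleton $S(\Gamma)$ is obtained from $B(\Gamma)$ by deleting all dispensable edges. -}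

module Defs where

open import Data.Nat using (ℕ; _<_; _≤_)
open import Data.Fin using (Fin)
open import Data.Bool using (Bool; true; false)
open import Data.Product using (Σ; ∃; ∃-syntax; _×_; _,_; proj₁; proj₂)
open import Data.Sum using (_⊎_)
open import Data.Empty using (⊥-elim)
open import Relation.Nullary using (¬_)
open import Relation.Unary using (Pred; _∩_; _⊂_)
open import Relation.Binary.PropositionalEquality using (_≡_; _≢_; refl; trans; sym)
open import Relation.Binary.Construct.Closure.ReflexiveTransitive using (Star)
open import Function.Bundles using (_↔_; _⇔_; Inverse; Equivalence)

-- Finite undirected graphs (loops allowed, no multiple edges) on Fin n.

record Graph (n : ℕ) : Set₁ where
  field
    adj : Fin n → Fin n → Set
    adj-sym : ∀ {u v} → adj u v → adj v u
open Graph public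

N : ∀ {n} → Graph n → Fin n → Pred (Fin n) _
N Γ u = λ w → adj Γ u w

Connected : ∀ {n} → Graph n → Set
Connected Γ = ∀ u v → Star (adj Γ) u v

TwinFree : ∀ {n} → Graph n → Set
TwinFree {n} Γ = ∀ u v → (∀ w → adj Γ u w ⇔ adj Γ v w) → u ≡ v

IsAut : ∀ {A : Set} → (A → A → Set) → A ↔ A → Set
IsAut R f = ∀ x y → R x y ⇔ R (Inverse.to f x) (Inverse.to f y)

DirAdj : ∀ {n m} → Graph n → Graph m → Fin n × Fin m → Fin n × Fin m → Set
DirAdj Γ Σ' (u , i) (v , j) = adj Γ u v × adj Σ' i j

CartAdj : ∀ {n m} → Graph n → Graph m → Fin n × Fin m → Fin n × Fin m → Set
CartAdj Γ Σ' (u , i) (v , j) = (u ≡ v × adj Σ' i j) ⊎ (i ≡ j × adj Γ u v)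

K2 : Graph 2
K2 = record { adj = λ i j → i ≢ j ; adj-sym = λ p q → p (sym q) }

Stable : ∀ {n} → Graph n → Set
Stable {n} Γ = ∀ (f : (Fin n × Fin 2) ↔ (Fin n × Fin 2)) →
  IsAut (DirAdj Γ K2) f ⇔
  (∃[ σ ] ∃[ τ ] (IsAut (adj Γ) σ × IsAut (adj K2) τ ×
     (∀ x → Inverse.to f x ≡ (Inverse.to σ (proj₁ x) , Inverse.to τ (proj₂ x)))))

-- Bipartite with bipartition given by inU (true = part U, false = part W).
Bipartition : ∀ {m} → Graph m → (Fin m → Bool) → Set
Bipartition Σ' inU = ∀ i j → adj Σ' i j → inU i ≢ inU j

AtLeast3 : ∀ {m} → (Fin m → Bool) → Bool → Set
AtLeast3 inU b = ∃[ x ] ∃[ y ] ∃[ z ]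
  (inU x ≡ b × inU y ≡ b × inU z ≡ b × x ≢ y × x ≢ z × y ≢ z)

-- g preserves (permutes the blocks of) the A-partition {{a} × B : a ∈ A}:
-- the image of every block is a block.
PreservesAPartition : ∀ {A B : Set} → (A × B → A × B) → Set
PreservesAPartition {A} {B} g =
  ∀ (a : A) → ∃[ a' ] ∀ (y : A × B) → (∃[ b ] g (a , b) ≡ y) ⇔ (proj₁ y ≡ a')

-- g preserves the B-partition {A × {b} : b ∈ B}.
PreservesBPartition : ∀ {A B : Set} → (A × B → A × B) → Set
PreservesBPartition {A} {B} g =
  ∀ (b : B) → ∃[ b' ] ∀ (y : A × B) → (∃[ a ] g (a , b) ≡ y) ⇔ (proj₂ y ≡ b')

AMixer : ∀ {A B : Set} → (A × B → A × B) → Set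
AMixer g = ¬ PreservesAPartition g

BMixer : ∀ {A B : Set} → (A × B → A × B) → Set
BMixer g = ¬ PreservesBPartition g

Part : ∀ {m} → (Fin m → Bool) → Bool → Set
Part {m} inU b = Σ (Fin m) (λ i → inU i ≡ b)

Stabilizes : ∀ {n m} → (Fin m → Bool) → (Fin n × Fin m) ↔ (Fin n × Fin m) → Set
Stabilizes inU ρ = ∀ x → (inU (proj₂ x) ≡ true) ⇔ (inU (proj₂ (Inverse.to ρ x)) ≡ true)

private
  notTrue : ∀ {c d : Bool} → (c ≡ true ⇔ d ≡ true) → c ≡ false → d ≡ false
  notTrue {c} {false} e p = refl
  notTrue {false} {true} e p with Equivalence.from e refl
  ... | ()
  notTrue {true} {true} e ()

restrictU : ∀ {n m} (inU : Fin m → Bool) (ρ : (Fin n × Fin m) ↔ (Fin n × Fin m)) →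
  Stabilizes inU ρ → Fin n × Part inU true → Fin n × Part inU true
restrictU inU ρ st (a , (i , p)) =
  proj₁ (Inverse.to ρ (a , i)) ,
  (proj₂ (Inverse.to ρ (a , i)) , Equivalence.to (st (a , i)) p)

restrictW : ∀ {n m} (inU : Fin m → Bool) (ρ : (Fin n × Fin m) ↔ (Fin n × Fin m)) →
  Stabilizes inU ρ → Fin n × Part inU false → Fin n × Part inU false
restrictW inU ρ st (a , (i , p)) =
  proj₁ (Inverse.to ρ (a , i)) ,
  (proj₂ (Inverse.to ρ (a , i)) , notTrue (st (a , i)) p)

BAdj : ∀ {n} → Graph n → Fin n → Fin n → Set
BAdj Γ u v = u ≢ v × ∃[ w ] (N Γ u w × N Γ v w)

Dispensable : ∀ {n} → Graph n → Fin n → Fin n → Set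
Dispensable Γ u v = ∃[ w ]
  (((N Γ u ∩ N Γ v) ⊂ (N Γ u ∩ N Γ w) ⊎ (N Γ u ⊂ N Γ w × N Γ w ⊂ N Γ v)) ×
   ((N Γ v ∩ N Γ u) ⊂ (N Γ v ∩ N Γ w) ⊎ (N Γ v ⊂ N Γ w × N Γ w ⊂ N Γ u)))

SAdj : ∀ {n} → Graph n → Fin n → Fin n → Set
SAdj Γ u v = BAdj Γ u v × ¬ Dispensable Γ u v

CartesianPrime : ∀ {n} → (Fin n → Fin n → Set) → Set₁
CartesianPrime {n} R = 1 < n ×
  ¬ (∃[ a ] ∃[ b ] Σ (Graph a) λ G₁ → Σ (Graph b) λ G₂ →
       a < n × b < n ×
       Σ (Fin n ↔ (Fin a × Fin b)) λ f →
         ∀ u v → R u v ⇔ CartAdj G₁ G₂ (Inverse.to f u) (Inverse.to f v))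

-- Suppose the restriction of ρ to one side of Σ permuted the layers V(Γ) × {i}.
-- Since Σ is twin-free, so does the restriction to the other side, and ρ⁻¹ likewise;
-- hence ρ (a , i) = (σᵢ a , π i) with bijections σᵢ.  For an edge i ~ j of Σ the pair
-- (σᵢ , σⱼ) is an automorphism of Γ × K₂, so stability of Γ forces σᵢ = σⱼ, and by
-- connectivity of Σ all σᵢ coincide: ρ would preserve the Γ-partition, which a
-- Γ-mixer does not.
module Submission where

open import Defs
open import Data.Nat using (suc; _<_; s≤s)
open import Data.Nat.Properties using (<⇒≤)
open import Data.Fin using (Fin; zero; suc; fromℕ<)
open import Data.Bool using (Bool; true; false; not; _≟_)
open import Data.Bool.Properties using (¬-not; not-involutive)
open import Data.Product using (Σ; ∃-syntax; _×_; _,_; proj₁; proj₂)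
open import Relation.Nullary using (yes; no; contradiction)
open import Relation.Binary.PropositionalEquality
open import Relation.Binary.Construct.Closure.ReflexiveTransitive using (Star; ε; _◅_)
open import Function.Base using (_∘_)
open import Function.Bundles using (_↔_; _⇔_; Inverse; Equivalence; mk⇔; mk↔ₛ′)
open import Function.Properties.Inverse using (↔-sym)
import Function.Properties.Equivalence as ⇔

IsAut-sym : ∀ {A : Set} {R : A → A → Set} (f : A ↔ A) → IsAut R f → IsAut R (↔-sym f)
IsAut-sym {R = R} f aut x y =
  ⇔.sym (subst₂ (λ x′ y′ → R (from x) (from y) ⇔ R x′ y′)
                (strictlyInverseˡ x) (strictlyInverseˡ y) (aut (from x) (from y)))
  where open Inverse f

connected⇒nonIsolated : ∀ {n} (G : Graph n) → Connected G → 1 < n → ∀ a → ∃[ b ] adj G a b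
connected⇒nonIsolated {suc (suc _)} G connected (s≤s (s≤s _)) zero with connected zero (suc zero)
... | a~b ◅ _ = _ , a~b
connected⇒nonIsolated {suc (suc _)} G connected (s≤s (s≤s _)) (suc a) with connected (suc a) zero
... | a~b ◅ _ = _ , a~b

Stabilizes-reflects : ∀ {n m} {inU : Fin m → Bool} (ρ : (Fin n × Fin m) ↔ (Fin n × Fin m)) →
  Stabilizes inU ρ → ∀ b x → inU (proj₂ (Inverse.to ρ x)) ≡ b → inU (proj₂ x) ≡ b
Stabilizes-reflects ρ st true x = Equivalence.from (st x)
Stabilizes-reflects ρ st false x ρx∈W =
  ¬-not λ x∈U → contradiction (trans (sym (Equivalence.to (st x) x∈U)) ρx∈W) λ ()

unpart : ∀ {A B : Set} {Q : B → Set} → A × Σ B Q → A × B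
unpart (a , i , _) = a , i

fibrewise-↔ : ∀ {A C : Set} → (C → A ↔ A) → (A × C) ↔ (A × C)
fibrewise-↔ φ = mk↔ₛ′ (λ (a , c) → Inverse.to (φ c) a , c) (λ (a , c) → Inverse.from (φ c) a , c)
  (λ (a , c) → cong (_, c) (Inverse.strictlyInverseˡ (φ c) a))
  (λ (a , c) → cong (_, c) (Inverse.strictlyInverseʳ (φ c) a))

module _ {A B : Set} where

  PreservesLayer : (A × B → A × B) → B → Set
  PreservesLayer f i = ∀ a a′ → proj₂ (f (a , i)) ≡ proj₂ (f (a′ , i))

  MapsLayerOnto : (A × B) ↔ (A × B) → B → B → Set
  MapsLayerOnto ρ i k = ∀ y → (∃[ a ] Inverse.to ρ (a , i) ≡ y) ⇔ (proj₂ y ≡ k)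

  restriction-mapsLayerOnto : ∀ {Q : B → Set} (ρ : (A × B) ↔ (A × B)) (r : A × Σ B Q → A × Σ B Q) →
    (∀ x → unpart (r x) ≡ Inverse.to ρ (unpart x)) → PreservesBPartition r →
    ∀ i → Q i → ∃[ k ] MapsLayerOnto ρ i k
  restriction-mapsLayerOnto ρ r restricts preserves i q with preserves (i , q)
  ... | (k , k∈Q) , block = k , λ y → mk⇔ into onto
    where
    open Inverse ρ using (to)

    into : ∀ {y} → ∃[ a ] to (a , i) ≡ y → proj₂ y ≡ k
    into (a , refl) = trans (sym (cong proj₂ (restricts (a , i , q))))
                            (cong proj₁ (Equivalence.to (block (r (a , i , q))) (a , refl)))

    onto : ∀ {y} → proj₂ y ≡ k → ∃[ a ] to (a , i) ≡ y
    onto {c , _} refl with Equivalence.from (block (c , k , k∈Q)) refl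
    ... | a , r≡ = a , trans (sym (restricts (a , i , q))) (cong unpart r≡)

  module _ (ρ : (A × B) ↔ (A × B)) where
    open Inverse ρ

    mapsLayerOnto⇒preservesLayer : ∀ {i k} → MapsLayerOnto ρ i k → PreservesLayer to i
    mapsLayerOnto⇒preservesLayer {i} {k} onto a a′ = trans (inLayer a) (sym (inLayer a′))
      where
      inLayer : ∀ a → proj₂ (to (a , i)) ≡ k
      inLayer a = Equivalence.to (onto (to (a , i))) (a , refl)

    mapsLayerOnto⇒from : ∀ {i k} → MapsLayerOnto ρ i k → ∀ c → proj₂ (from (c , k)) ≡ i
    mapsLayerOnto⇒from {i} {k} onto c with Equivalence.from (onto (c , k)) refl
    ... | a , to≡ = cong proj₂ (trans (cong from (sym to≡)) (strictlyInverseʳ (a , i)))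

    mapsLayersOnto⇒fromPreservesLayer : ∀ {Q : B → Set} →
      (∀ x → Q (proj₂ (to x)) → Q (proj₂ x)) → (∀ i → Q i → ∃[ k ] MapsLayerOnto ρ i k) →
      ∀ k → Q k → PreservesLayer from k
    mapsLayersOnto⇒fromPreservesLayer {Q} reflects layersOnto k k∈Q c c′ =
      trans (fromLayer c) (sym (fromLayer c′))
      where
      x : A × B
      x = from (c , k)
      toFrom : to x ≡ (c , k)
      toFrom = strictlyInverseˡ (c , k)
      onto : ∃[ k′ ] MapsLayerOnto ρ (proj₂ x) k′
      onto = layersOnto (proj₂ x) (reflects x (subst Q (sym (cong proj₂ toFrom)) k∈Q))
      fromLayer : ∀ c → proj₂ (from (c , k)) ≡ proj₂ x
      fromLayer = subst (λ k → ∀ c → proj₂ (from (c , k)) ≡ proj₂ x)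
                        (sym (Equivalence.to (proj₂ onto (c , k)) (proj₁ x , toFrom)))
                        (mapsLayerOnto⇒from (proj₂ onto))

module LayerwiseForm {A B : Set} (ρ : (A × B) ↔ (A × B)) (a₀ : A)
  (layers : ∀ i → PreservesLayer (Inverse.to ρ) i)
  (layers⁻¹ : ∀ k → PreservesLayer (Inverse.from ρ) k) where
  open Inverse ρ

  σ : B → A → A
  σ i a = proj₁ (to (a , i))

  π : B → B
  π i = proj₂ (to (a₀ , i))

  to-σπ : ∀ a i → to (a , i) ≡ (σ i a , π i)
  to-σπ a i = cong (σ i a ,_) (layers i a a₀)

  from-π : ∀ c i → proj₂ (from (c , π i)) ≡ i
  from-π c i = begin
    proj₂ (from (c , π i))         ≡⟨ layers⁻¹ (π i) c (σ i a₀) ⟩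
    proj₂ (from (to (a₀ , i)))     ≡⟨ cong proj₂ (strictlyInverseʳ (a₀ , i)) ⟩
    i                              ∎
    where open ≡-Reasoning

  σ↔ : B → A ↔ A
  σ↔ i = mk↔ₛ′ (σ i) σ⁻¹ σσ⁻¹ σ⁻¹σ
    where
    σ⁻¹ : A → A
    σ⁻¹ c = proj₁ (from (c , π i))
    σσ⁻¹ : ∀ c → σ i (σ⁻¹ c) ≡ c
    σσ⁻¹ c = cong proj₁ (trans (cong (λ j → to (σ⁻¹ c , j)) (sym (from-π c i)))
                               (strictlyInverseˡ (c , π i)))
    σ⁻¹σ : ∀ a → σ⁻¹ (σ i a) ≡ a
    σ⁻¹σ a = cong proj₁ (trans (cong from (sym (to-σπ a i))) (strictlyInverseʳ (a , i)))

  σ-constant⇒preservesAPartition : ∀ i₀ → (∀ i a → σ i a ≡ σ i₀ a) → PreservesAPartition to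
  σ-constant⇒preservesAPartition i₀ constant a = σ i₀ a , λ y → mk⇔ into (onto y)
    where
    into : ∀ {y} → ∃[ i ] to (a , i) ≡ y → proj₁ y ≡ σ i₀ a
    into (i , refl) = constant i a
    onto : ∀ y → proj₁ y ≡ σ i₀ a → ∃[ i ] to (a , i) ≡ y
    onto y y₁≡ = i , (begin
      to (a , i)                   ≡⟨ to-σπ a i ⟩
      (σ i a , π i)                ≡⟨ cong₂ _,_ (trans (constant i a) (sym y₁≡))
                                                (trans (sym (layers i (proj₁ (from y)) a₀))
                                                       (cong proj₂ (strictlyInverseˡ y))) ⟩
      y                            ∎)
      where
      open ≡-Reasoning
      i = proj₂ (from y)

module _ {n m} {Γ : Graph n} {Σ' : Graph m} (hasNeighbour : ∀ a → ∃[ b ] adj Γ a b) where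

  private
    V : Set
    V = Fin n × Fin m

  neighbour-oppositeSide : ∀ {inU : Fin m → Bool} {w j b} → Bipartition Σ' inU →
    adj Σ' w j → inU w ≡ not b → inU j ≡ b
  neighbour-oppositeSide {inU} {w} {j} {b} bipartition w~j w∈¬b = begin
    inU j          ≡⟨ ¬-not (≢-sym (bipartition w j w~j)) ⟩
    not (inU w)    ≡⟨ cong not w∈¬b ⟩
    not (not b)    ≡⟨ not-involutive b ⟩
    b              ∎
    where open ≡-Reasoning

  neighbour-layerImage : ∀ (f : V ↔ V) → IsAut (DirAdj Γ Σ') f →
    ∀ {a w k} → adj Σ' (proj₂ (Inverse.to f (a , w))) k →
    ∃[ c ] ∃[ j ] adj Σ' w j × proj₂ (Inverse.to f (c , j)) ≡ k
  neighbour-layerImage f aut {a} {w} {k} h =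
    proj₁ x , proj₂ x , proj₂ (Equivalence.from (aut (a , w) x) fa~fx) , cong proj₂ toFrom
    where
    open Inverse f
    d : Fin n
    d = proj₁ (hasNeighbour (proj₁ (to (a , w))))
    x : V
    x = from (d , k)
    toFrom : to x ≡ (d , k)
    toFrom = strictlyInverseˡ (d , k)
    fa~fx : DirAdj Γ Σ' (to (a , w)) (to x)
    fa~fx = subst (DirAdj Γ Σ' (to (a , w))) (sym toFrom)
                  (proj₂ (hasNeighbour (proj₁ (to (a , w)))) , h)

  -- On the other side, the images of a layer have the same neighbours in Σ,
  -- namely the images of the (preserved) neighbouring layers; Σ is twin-free.
  bipartite-preservesLayers : ∀ {inU : Fin m → Bool} (f : V ↔ V) → IsAut (DirAdj Γ Σ') f →
    Bipartition Σ' inU → TwinFree Σ' → ∀ b →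
    (∀ i → inU i ≡ b → PreservesLayer (Inverse.to f) i) → ∀ i → PreservesLayer (Inverse.to f) i
  bipartite-preservesLayers {inU} f aut bipartition twinFree b layers w with inU w ≟ b
  ... | yes w∈b = layers w w∈b
  ... | no w∉b = λ a a′ → twinFree _ _ λ k → mk⇔ (sameNeighbours a a′) (sameNeighbours a′ a)
    where
    open Inverse f using (to)
    sameNeighbours : ∀ a a′ {k} → adj Σ' (proj₂ (to (a , w))) k → adj Σ' (proj₂ (to (a′ , w))) k
    sameNeighbours a a′ h with neighbour-layerImage f aut h
    ... | c , j , w~j , refl =
      subst (adj Σ' (proj₂ (to (a′ , w))))
            (layers j (neighbour-oppositeSide bipartition w~j (¬-not w∉b)) e c)
            (proj₂ (Equivalence.to (aut (a′ , w) (e , j)) (a′~e , w~j)))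
      where
      e : Fin n
      e = proj₁ (hasNeighbour a′)
      a′~e : adj Γ a′ e
      a′~e = proj₂ (hasNeighbour a′)

  module StableLayers (stable : Stable Γ) (ρ : V ↔ V) (aut : IsAut (DirAdj Γ Σ') ρ) (a₀ : Fin n)
    (layers : ∀ i → PreservesLayer (Inverse.to ρ) i)
    (layers⁻¹ : ∀ k → PreservesLayer (Inverse.from ρ) k) where
    open Inverse ρ using (to)
    open LayerwiseForm ρ a₀ layers layers⁻¹

    π-edge : ∀ {i j} → adj Σ' i j → adj Σ' (π i) (π j)
    π-edge {i} {j} i~j = subst (adj Σ' (π i)) (layers j e₀ a₀)
      (proj₂ (Equivalence.to (aut (a₀ , i) (e₀ , j)) (proj₂ (hasNeighbour a₀) , i~j)))
      where
      e₀ : Fin n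
      e₀ = proj₁ (hasNeighbour a₀)

    σ-edge : ∀ {i j} → adj Σ' i j → ∀ a b → adj Γ a b ⇔ adj Γ (σ i a) (σ j b)
    σ-edge {i} {j} i~j a b = mk⇔
      (λ a~b → proj₁ (Equivalence.to (aut (a , i) (b , j)) (a~b , i~j)))
      (λ σa~σb → proj₁ (Equivalence.from (aut (a , i) (b , j))
        (σa~σb , subst₂ (adj Σ') (sym (layers i a a₀)) (sym (layers j b a₀)) (π-edge i~j))))

    σ-edge-equal : ∀ {i j} → adj Σ' i j → ∀ a → σ i a ≡ σ j a
    σ-edge-equal {i} {j} i~j a with Equivalence.to (stable (fibrewise-↔ (σ↔ ∘ end))) σ↔-aut
      where
      end : Fin 2 → Fin m
      end zero = i
      end (suc _) = j
      ends-adjacent : ∀ s t → s ≢ t → adj Σ' (end s) (end t)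
      ends-adjacent zero zero s≢t = contradiction refl s≢t
      ends-adjacent zero (suc zero) _ = i~j
      ends-adjacent (suc zero) zero _ = adj-sym Σ' i~j
      ends-adjacent (suc zero) (suc zero) s≢t = contradiction refl s≢t
      σ↔-aut : IsAut (DirAdj Γ K2) (fibrewise-↔ (σ↔ ∘ end))
      σ↔-aut (a , s) (b , t) = mk⇔
        (λ (a~b , s≢t) → Equivalence.to (σ-edge (ends-adjacent s t s≢t) a b) a~b , s≢t)
        (λ (σa~σb , s≢t) → Equivalence.from (σ-edge (ends-adjacent s t s≢t) a b) σa~σb , s≢t)
    ... | _ , _ , _ , _ , factors =
      trans (cong proj₁ (factors (a , zero))) (sym (cong proj₁ (factors (a , suc zero))))

    σ-path-equal : ∀ {i k} → Star (adj Σ') i k → ∀ a → σ i a ≡ σ k a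
    σ-path-equal ε a = refl
    σ-path-equal (i~j ◅ path) a = trans (σ-edge-equal i~j a) (σ-path-equal path a)

    connected⇒preservesAPartition : Connected Σ' → Fin m → PreservesAPartition to
    connected⇒preservesAPartition connected u₀ = σ-constant⇒preservesAPartition u₀
      λ i a → sym (σ-path-equal (connected u₀ i) a)

  restriction⇒preservesAPartition : ∀ {inU : Fin m → Bool} → Stable Γ →
    Connected Σ' → TwinFree Σ' → Bipartition Σ' inU →
    (ρ : V ↔ V) → IsAut (DirAdj Γ Σ') ρ → Stabilizes inU ρ → Fin n → Fin m →
    ∀ b (r : Fin n × Part inU b → Fin n × Part inU b) →
    (∀ x → unpart (r x) ≡ Inverse.to ρ (unpart x)) →
    PreservesBPartition r → PreservesAPartition (Inverse.to ρ)
  restriction⇒preservesAPartition {inU} stable connected twinFree bipartition ρ aut st a₀ u₀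
    b r restricts preserves =
    StableLayers.connected⇒preservesAPartition stable ρ aut a₀ layers layers⁻¹ connected u₀
    where
    layersOnto : ∀ i → inU i ≡ b → ∃[ k ] MapsLayerOnto ρ i k
    layersOnto = restriction-mapsLayerOnto ρ r restricts preserves
    layers : ∀ i → PreservesLayer (Inverse.to ρ) i
    layers = bipartite-preservesLayers ρ aut bipartition twinFree b
      λ i i∈b → mapsLayerOnto⇒preservesLayer ρ (proj₂ (layersOnto i i∈b))
    layers⁻¹ : ∀ k → PreservesLayer (Inverse.from ρ) k
    layers⁻¹ = bipartite-preservesLayers (↔-sym ρ) (IsAut-sym ρ aut) bipartition twinFree b
      (mapsLayersOnto⇒fromPreservesLayer ρ (Stabilizes-reflects ρ st b) layersOnto)

lemma4p5 : ∀ {n m} (Γ : Graph n) (Σ' : Graph m) (inU : Fin m → Bool) →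
    Connected Γ → TwinFree Γ → Stable Γ →
    Connected Σ' → TwinFree Σ' →
    Bipartition Σ' inU → AtLeast3 inU true → AtLeast3 inU false →
    (ρ : (Fin n × Fin m) ↔ (Fin n × Fin m)) →
    IsAut (DirAdj Γ Σ') ρ →
    AMixer (Inverse.to ρ) →
    (st : Stabilizes inU ρ) →
    CartesianPrime (SAdj Γ) →
    BMixer (restrictU inU ρ st) × BMixer (restrictW inU ρ st)
lemma4p5 {n} {m} Γ Σ' inU connectedΓ _ stable connectedΣ twinFreeΣ bipartition (u₀ , _) _
  ρ aut mixer st (1<n , _) =
  (λ preserves → mixer (fromRestriction true (restrictU inU ρ st) (λ _ → refl) preserves)) ,
  (λ preserves → mixer (fromRestriction false (restrictW inU ρ st) (λ _ → refl) preserves))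
  where
  fromRestriction : ∀ b (r : Fin n × Part inU b → Fin n × Part inU b) →
    (∀ x → unpart (r x) ≡ Inverse.to ρ (unpart x)) →
    PreservesBPartition r → PreservesAPartition (Inverse.to ρ)
  fromRestriction = restriction⇒preservesAPartition {Γ = Γ} {Σ' = Σ'}
    (connected⇒nonIsolated Γ connectedΓ 1<n)
    stable connectedΣ twinFreeΣ bipartition ρ aut st (fromℕ< (<⇒≤ 1<n)) u₀
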